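{- Let $d\ge 2$ and $n,k\ge 0$ be integers. Then $N_d(n,k)$ equals the number of labelled Dyck paths in $\widetilde{\mathcal{Q}}_d$ with semilength $n+1$ and exactly $k$ instances of $UU$.
   Context: $N_d(n,k) = \frac{1}{n+1} \binom{n+1}{k+1} \binom{ n + (n-k)(d-2)+1}{k}$. A Dyck path is a lattice path from $(0,0)$ with up steps $U=(1,1)$ and down steps $D=(1,-1)$, never going below the $x$-axis and ending on it at $(2m,0)$; $m$ is its semilength. A descent is a maximal run of consecutive down steps. $\widetilde{\mathcal{Q}}_d$ is the set of pairs consisting of a nonempty Dyck path together with a labelling in which the last descent is unlabelled and every other descent, of length $\ell\ge 1$, is labelled by a composition of $\ell-1$ into $d-1$ nonnegative parts. An instance of $UU$ is a position where an up step is immediately followed by an up step. -}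

module Defs where

open import Data.Nat using (ℕ; zero; suc; _+_; _*_; _∸_; _/_)
open import Data.Nat.Combinatorics using (_C_)
open import Data.Bool using (Bool; true; false; T)
open import Data.List using (List; []; _∷_)
open import Data.Vec using (Vec)
open import Data.Unit using (⊤)
open import Data.Product using (Σ; _×_)
open import Relation.Binary.PropositionalEquality using (_≡_)

-- N_d(n,k) = 1/(n+1) * C(n+1,k+1) * C(n + (n-k)(d-2) + 1, k)
-- (an integer; when k > n the first binomial vanishes, so truncated ∸ is harmless)
N : ℕ → ℕ → ℕ → ℕ
N d n k = (((n + 1) C (k + 1)) * ((n + (n ∸ k) * (d ∸ 2) + 1) C k)) / suc n

-- Lattice path steps: U = (1,1), D = (1,-1)
data Step : Set where
  U D : Step

dyckFrom : ℕ → List Step → Bool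
dyckFrom zero    []      = true
dyckFrom (suc h) []      = false
dyckFrom h       (U ∷ s) = dyckFrom (suc h) s
dyckFrom zero    (D ∷ s) = false
dyckFrom (suc h) (D ∷ s) = dyckFrom h s

isDyck : List Step → Bool
isDyck = dyckFrom zero

semilength : List Step → ℕ
semilength []      = zero
semilength (U ∷ s) = suc (semilength s)
semilength (D ∷ s) = semilength s

countUU : List Step → ℕ
countUU []            = zero
countUU (U ∷ U ∷ s)   = suc (countUU (U ∷ s))
countUU (U ∷ D ∷ s)   = countUU (D ∷ s)
countUU (U ∷ [])      = zero
countUU (D ∷ s)       = countUU s

-- lengths of the descents (maximal runs of D), in left-to-right order
private
  flush : ℕ → List ℕ → List ℕ
  flush zero    l = l
  flush (suc c) l = suc c ∷ l

descentsFrom : ℕ → List Step → List ℕ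
descentsFrom c []      = flush c []
descentsFrom c (D ∷ s) = descentsFrom (suc c) s
descentsFrom c (U ∷ s) = flush c (descentsFrom zero s)

descents : List Step → List ℕ
descents = descentsFrom zero

sumV : ∀ {p} → Vec ℕ p → ℕ
sumV Vec.[]       = zero
sumV (x Vec.∷ xs) = x + sumV xs

Composition : ℕ → ℕ → Set
Composition s p = Σ (Vec ℕ p) (λ v → sumV v ≡ s)

-- labels for a list of descent lengths: the last descent is unlabelled,
-- every other descent of length ℓ gets a composition of ℓ-1 into d-1 parts
Labels : ℕ → List ℕ → Set
Labels d []                = ⊤
Labels d (ℓ ∷ [])          = ⊤
Labels d (ℓ ∷ ℓ' ∷ rest)   = Composition (ℓ ∸ 1) (d ∸ 1) × Labels d (ℓ' ∷ rest)

LabelledPaths : ℕ → ℕ → ℕ → Set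
LabelledPaths d m k =
  Σ (List Step) λ P →
    T (isDyck P) × semilength P ≡ m × countUU P ≡ k × Labels d (descents P)

-- Reading a path backwards moves its unlabelled last descent to the front, so a labelled path
-- is scanned step by step, from its end, by a transfer recursion whose state is the height,
-- the length of the current run of down steps, whether the last step was up, whether labels
-- have started, and the number of UU still to come; splitting on the next step is a bijection
-- onto Fin of the recursion's value.  With multiset coefficients M(q, x) = C(q + x - 1, x), the
-- absorption identity x M(q, x) = q M(q + 1, x - 1) and Vandermonde's convolution then solve the
-- recursion in closed form: (n + 1) times the number of paths of semilength n + 1 with k
-- instances of UU is M(k + 2, n - k) M(2 + (n - k)(d - 1), k), which is
-- C(n + 1, k + 1) C(n + (n - k)(d - 2) + 1, k).

module Submission where

open import Defs
open import Data.Nat using (ℕ; _≤_; _+_)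
open import Data.Fin using (Fin)
open import Function.Bundles using (_↔_)

import Algebra.Properties.CommutativeSemigroup as CommutativeSemigroupProperties
open import Data.Bool using (Bool; true; false; T)
open import Data.Empty using (⊥; ⊥-elim)
open import Data.Fin.Properties using (+↔⊎; *↔×; 0↔⊥; 1↔⊤)
open import Data.List using (List; []; _∷_; _++_; [_]; map; reverse; replicate)
open import Data.List.Properties using (++-assoc; ++-identityʳ; map-++; unfold-reverse; reverse-involutive)
open import Data.Nat
open import Data.Nat.Combinatorics using (_C_; nCn≡1; nCk+nC[k+1]≡[n+1]C[k+1]; k>n⇒nCk≡0)
open import Data.Nat.DivMod using (m*n/n≡m; 0/n≡0)
open import Data.Nat.Properties
open import Data.Nat.Tactic.RingSolver using (solve-∀)
open import Data.Product using (Σ; _×_; _,_; proj₂)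
open import Data.Product.Function.Dependent.Propositional using (Σ-↔)
open import Data.Product.Function.NonDependent.Propositional using (_×-↔_)
open import Data.Sum using (_⊎_; inj₁; inj₂)
open import Data.Sum.Function.Propositional using (_⊎-↔_)
open import Data.Unit using (⊤; tt)
open import Data.Vec using (Vec; []; _∷_)
open import Function.Bundles using (mk↔ₛ′)
open import Function.Properties.Inverse using (↔-trans; ↔-sym; ↔-refl)
open import Function.Related.Propositional using (module EquationalReasoning)
open import Relation.Binary.PropositionalEquality hiding ([_])
open import Relation.Nullary using (yes; no)

open CommutativeSemigroupProperties +-commutativeSemigroup using (interchange; x∙yz≈y∙xz)

-- Multiset coefficients and Vandermonde's convolution

multichoose : ℕ → ℕ → ℕ
multichoose _       zero    = 1
multichoose zero    (suc x) = 0
multichoose (suc q) (suc x) = multichoose (suc q) x + multichoose q (suc x)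

multichoose-1ˡ : ∀ x → multichoose 1 x ≡ 1
multichoose-1ˡ zero    = refl
multichoose-1ˡ (suc x) = trans (+-identityʳ _) (multichoose-1ˡ x)

multichoose-2ˡ : ∀ x → multichoose 2 x ≡ suc x
multichoose-2ˡ zero    = refl
multichoose-2ˡ (suc x) =
  trans (cong₂ _+_ (multichoose-2ˡ x) (multichoose-1ˡ (suc x))) (+-comm (suc x) 1)

multichoose-1ʳ : ∀ q → multichoose q 1 ≡ q
multichoose-1ʳ zero    = refl
multichoose-1ʳ (suc q) = cong suc (multichoose-1ʳ q)

multichoose-sym : ∀ q x → multichoose (suc q) x ≡ multichoose (suc x) q
multichoose-sym q       zero    = sym (multichoose-1ˡ q)
multichoose-sym zero    (suc x) = trans (+-identityʳ _) (multichoose-1ˡ x)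
multichoose-sym (suc q) (suc x) = begin
  multichoose (suc (suc q)) x + multichoose (suc q) (suc x)
    ≡⟨ cong₂ _+_ (multichoose-sym (suc q) x) (multichoose-sym q (suc x)) ⟩
  multichoose (suc x) (suc q) + multichoose (suc (suc x)) q
    ≡⟨ +-comm (multichoose (suc x) (suc q)) _ ⟩
  multichoose (suc (suc x)) q + multichoose (suc x) (suc q) ∎
  where open ≡-Reasoning

multichoose-absorption : ∀ q x → suc x * multichoose q (suc x) ≡ q * multichoose (suc q) x
multichoose-absorption zero    x       = *-zeroʳ (suc x)
multichoose-absorption (suc q) zero    =
  trans (+-identityʳ _) (trans (cong suc (multichoose-1ʳ q)) (sym (*-identityʳ (suc q))))
multichoose-absorption (suc q) (suc x) = begin
  suc (suc x) * (M + multichoose q (suc (suc x)))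
    ≡⟨ *-distribˡ-+ (suc (suc x)) M _ ⟩
  suc (suc x) * M + suc (suc x) * multichoose q (suc (suc x))
    ≡⟨ cong (suc (suc x) * M +_) (multichoose-absorption q (suc x)) ⟩
  suc (suc x) * M + q * M
    ≡⟨ shift (suc x) q M ⟩
  suc x * M + suc q * M
    ≡⟨ cong (_+ suc q * M) (multichoose-absorption (suc q) x) ⟩
  suc q * multichoose (suc (suc q)) x + suc q * M
    ≡⟨ sym (*-distribˡ-+ (suc q) (multichoose (suc (suc q)) x) M) ⟩
  suc q * (multichoose (suc (suc q)) x + M) ∎
  where
  open ≡-Reasoning
  M = multichoose (suc q) (suc x)
  shift : ∀ y q M → suc y * M + q * M ≡ y * M + suc q * M
  shift = solve-∀

multichoose-absorption′ : ∀ q x → (q + x) * multichoose q x ≡ q * multichoose (suc q) x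
multichoose-absorption′ q zero    = cong (_* 1) (+-identityʳ q)
multichoose-absorption′ q (suc x) = begin
  (q + suc x) * M                   ≡⟨ cong (_* M) (+-comm q (suc x)) ⟩
  (suc x + q) * M                   ≡⟨ *-distribʳ-+ M (suc x) q ⟩
  suc x * M + q * M                 ≡⟨ cong (_+ q * M) (multichoose-absorption q x) ⟩
  q * multichoose (suc q) x + q * M ≡⟨ *-distribˡ-+ q _ M ⟨
  q * multichoose (suc q) (suc x)   ∎
  where
  open ≡-Reasoning
  M = multichoose q (suc x)

C≡multichoose : ∀ q x → (q + x) C x ≡ multichoose (suc q) x
C≡multichoose q       zero    = refl
C≡multichoose zero    (suc x) = trans (nCn≡1 (suc x)) (sym (multichoose-1ˡ (suc x)))
C≡multichoose (suc q) (suc x) =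
  trans (sym (nCk+nC[k+1]≡[n+1]C[k+1] (q + suc x) x))
        (cong₂ _+_ (trans (cong (_C x) (+-suc q x)) (C≡multichoose (suc q) x))
                   (C≡multichoose q (suc x)))

-- convolution f g L = Σ_{x ≤ L} f x * g (L ∸ x)
convolution : (ℕ → ℕ) → (ℕ → ℕ) → ℕ → ℕ
convolution f g zero    = f 0 * g 0
convolution f g (suc L) = f 0 * g (suc L) + convolution (λ x → f (suc x)) g L

convolution-congˡ : ∀ {f f′} g L → (∀ x → f x ≡ f′ x) → convolution f g L ≡ convolution f′ g L
convolution-congˡ g zero    f≗f′ = cong (_* g 0) (f≗f′ 0)
convolution-congˡ g (suc L) f≗f′ =
  cong₂ _+_ (cong (_* g (suc L)) (f≗f′ 0)) (convolution-congˡ g L (λ x → f≗f′ (suc x)))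

convolution-distribʳ-+ : ∀ f f′ g L →
  convolution (λ x → f x + f′ x) g L ≡ convolution f g L + convolution f′ g L
convolution-distribʳ-+ f f′ g zero    = *-distribʳ-+ (g 0) (f 0) (f′ 0)
convolution-distribʳ-+ f f′ g (suc L) =
  trans (cong₂ _+_ (*-distribʳ-+ (g (suc L)) (f 0) (f′ 0))
                   (convolution-distribʳ-+ (λ x → f (suc x)) (λ x → f′ (suc x)) g L))
        (interchange (f 0 * g (suc L)) _ _ _)

convolution-scaleˡ : ∀ c f g L → convolution (λ x → c * f x) g L ≡ c * convolution f g L
convolution-scaleˡ c f g zero    = *-assoc c (f 0) (g 0)
convolution-scaleˡ c f g (suc L) =
  trans (cong₂ _+_ (*-assoc c (f 0) (g (suc L))) (convolution-scaleˡ c (λ x → f (suc x)) g L))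
        (sym (*-distribˡ-+ c _ _))

convolution-zeroˡ : ∀ g L → convolution (λ _ → 0) g L ≡ 0
convolution-zeroˡ g zero    = refl
convolution-zeroˡ g (suc L) = convolution-zeroˡ g L

multichoose-vandermonde : ∀ q r L →
  convolution (multichoose q) (multichoose r) L ≡ multichoose (q + r) L
multichoose-vandermonde zero    r zero    = +-identityʳ _
multichoose-vandermonde zero    r (suc L) =
  trans (cong₂ _+_ (+-identityʳ _) (convolution-zeroˡ (multichoose r) L)) (+-identityʳ _)
multichoose-vandermonde (suc q) r zero    = refl
multichoose-vandermonde (suc q) r (suc L) = begin
  1 * M (suc L) + convolution (λ x → multichoose (suc q) (suc x)) M L
    ≡⟨ cong (1 * M (suc L) +_)
            (convolution-distribʳ-+ (multichoose (suc q)) (λ x → multichoose q (suc x)) M L) ⟩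
  1 * M (suc L) + (convolution (multichoose (suc q)) M L + rest)
    ≡⟨ x∙yz≈y∙xz (1 * M (suc L)) (convolution (multichoose (suc q)) M L) rest ⟩
  convolution (multichoose (suc q)) M L + convolution (multichoose q) M (suc L)
    ≡⟨ cong₂ _+_ (multichoose-vandermonde (suc q) r L) (multichoose-vandermonde q r (suc L)) ⟩
  multichoose (suc (q + r)) L + multichoose (q + r) (suc L) ∎
  where
  open ≡-Reasoning
  M = multichoose r
  rest = convolution (λ x → multichoose q (suc x)) M L

multichoose-vandermonde-weighted : ∀ q b L →
  suc b * convolution (λ x → x * multichoose q x) (multichoose (b * q)) L ≡ L * multichoose (suc b * q) L
multichoose-vandermonde-weighted q b zero    = *-zeroʳ (suc b)
multichoose-vandermonde-weighted q b (suc L) = begin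
  suc b * (0 * 1 * M (suc L) + convolution (λ x → suc x * multichoose q (suc x)) M L)
    ≡⟨ cong (suc b *_) (convolution-congˡ M L (multichoose-absorption q)) ⟩
  suc b * convolution (λ x → q * multichoose (suc q) x) M L
    ≡⟨ cong (suc b *_) (convolution-scaleˡ q (multichoose (suc q)) M L) ⟩
  suc b * (q * convolution (multichoose (suc q)) M L)
    ≡⟨ cong (λ n → suc b * (q * n)) (multichoose-vandermonde (suc q) (b * q) L) ⟩
  suc b * (q * multichoose (suc q + b * q) L)
    ≡⟨ *-assoc (suc b) q _ ⟨
  suc b * q * multichoose (suc (suc b * q)) L
    ≡⟨ multichoose-absorption (suc b * q) L ⟨
  suc L * multichoose (suc b * q) (suc L) ∎
  where
  open ≡-Reasoning
  M = multichoose (b * q)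

-- The inductive step of afterUp-closed below, as arithmetic; multiplying by (b + 1)(m + 1) makes
-- each hypothesis applicable in turn.
closed-form-step : ∀ b m h L up run X Y W M t →
  suc m ≡ L + suc b + h →
  suc m * up ≡ h * X * M →
  suc m * run ≡ W * t →
  (suc (h + L) + suc b) * X ≡ suc (h + L) * Y →
  (suc (h + L) + suc b) * W ≡ suc b * Y →
  suc b * t ≡ (suc b * suc h + L) * M →
  suc (suc m) * (up + run) ≡ suc h * Y * M
closed-form-step b m h L up run X Y W M t n≡ up≡ run≡ X≡ W≡ t≡ = *-cancelˡ-≡ _ _ (a * n) (begin
  a * n * (suc n * (up + run))
    ≡⟨ ring₁ a n up run ⟩
  a * suc n * (n * up) + suc n * (a * (n * run))
    ≡⟨ cong₂ (λ u r → a * suc n * u + suc n * (a * r)) up≡ run≡ ⟩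
  a * suc n * (h * X * M) + suc n * (a * (W * t))
    ≡⟨ ring₂ a n h X M W t ⟩
  a * h * M * (suc n * X) + suc n * W * (a * t)
    ≡⟨ cong (λ s → a * h * M * (s * X) + s * W * (a * t)) suc-n≡ ⟩
  a * h * M * ((q + a) * X) + (q + a) * W * (a * t)
    ≡⟨ cong₂ (λ x y → a * h * M * x + y) X≡ (cong₂ _*_ W≡ t≡) ⟩
  a * h * M * (q * Y) + a * Y * ((a * suc h + L) * M)
    ≡⟨ ring₃ a h M q Y L ⟩
  a * Y * M * (h * q + a * suc h + L)
    ≡⟨ cong (a * Y * M *_) (trans (ring₄ h L a) (cong (_* suc h) (sym n≡))) ⟩
  a * Y * M * (n * suc h)
    ≡⟨ ring₅ a Y M n h ⟩
  a * n * (suc h * Y * M) ∎)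
  where
  open ≡-Reasoning
  a = suc b
  n = suc m
  q = suc (h + L)
  suc-n≡ : suc n ≡ q + a
  suc-n≡ = trans (cong suc n≡) (ring₀ L b h)
    where
    ring₀ : ∀ L b h → suc (L + suc b + h) ≡ suc (h + L) + suc b
    ring₀ = solve-∀
  ring₁ : ∀ a n up run → a * n * (suc n * (up + run)) ≡ a * suc n * (n * up) + suc n * (a * (n * run))
  ring₁ = solve-∀
  ring₂ : ∀ a n h X M W t →
          a * suc n * (h * X * M) + suc n * (a * (W * t)) ≡ a * h * M * (suc n * X) + suc n * W * (a * t)
  ring₂ = solve-∀
  ring₃ : ∀ a h M q Y L → a * h * M * (q * Y) + a * Y * ((a * suc h + L) * M) ≡ a * Y * M * (h * q + a * suc h + L)
  ring₃ = solve-∀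
  ring₄ : ∀ h L a → h * suc (h + L) + a * suc h + L ≡ (L + a + h) * suc h
  ring₄ = solve-∀
  ring₅ : ∀ a Y M n h → a * Y * M * (n * suc h) ≡ a * n * (suc h * Y * M)
  ring₅ = solve-∀

↔Fin0 : {A : Set} → (A → ⊥) → A ↔ Fin 0
↔Fin0 ¬a = ↔-trans (mk↔ₛ′ ¬a (λ ()) (λ ()) (λ a → ⊥-elim (¬a a))) (↔-sym 0↔⊥)

↔Fin1 : {A : Set} (a : A) → (∀ x → x ≡ a) → A ↔ Fin 1
↔Fin1 a unique = ↔-trans (mk↔ₛ′ (λ _ → tt) (λ _ → a) (λ _ → refl) (λ x → sym (unique x))) (↔-sym 1↔⊤)

_⊎-Fin_ : {A B : Set} {m n : ℕ} → A ↔ Fin m → B ↔ Fin n → (A ⊎ B) ↔ Fin (m + n)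
f ⊎-Fin g = ↔-trans (f ⊎-↔ g) (↔-sym +↔⊎)

_×-Fin_ : {A B : Set} {m n : ℕ} → A ↔ Fin m → B ↔ Fin n → (A × B) ↔ Fin (m * n)
f ×-Fin g = ↔-trans (f ×-↔ g) (↔-sym *↔×)

Σ-congʳ : {I : Set} {A B : I → Set} → (∀ x → A x ↔ B x) → Σ I A ↔ Σ I B
Σ-congʳ f = Σ-↔ ↔-refl (f _)

Fin1×↔ : {A : Set} → A ↔ (Fin 1 × A)
Fin1×↔ = mk↔ₛ′ (λ a → Fin.zero , a) proj₂ (λ { (Fin.zero , a) → refl ; (Fin.suc () , _) }) (λ _ → refl)
  where import Data.Fin as Fin

suc≡suc↔ : {m n : ℕ} → (suc m ≡ suc n) ↔ (m ≡ n)
suc≡suc↔ = mk↔ₛ′ suc-injective (cong suc) (λ _ → ≡-irrelevant _ _) (λ _ → ≡-irrelevant _ _)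

≡⇒↔ : {A B : Set} → A ≡ B → A ↔ B
≡⇒↔ refl = ↔-refl

List-Step-cases↔ : {B : List Step → Set} →
  Σ (List Step) B ↔ (B [] ⊎ (Σ (List Step) (λ R → B (U ∷ R)) ⊎ Σ (List Step) (λ R → B (D ∷ R))))
List-Step-cases↔ = mk↔ₛ′
  (λ { ([] , b) → inj₁ b ; (U ∷ R , b) → inj₂ (inj₁ (R , b)) ; (D ∷ R , b) → inj₂ (inj₂ (R , b)) })
  (λ { (inj₁ b) → [] , b ; (inj₂ (inj₁ (R , b))) → U ∷ R , b ; (inj₂ (inj₂ (R , b))) → D ∷ R , b })
  (λ { (inj₁ b) → refl ; (inj₂ (inj₁ _)) → refl ; (inj₂ (inj₂ _)) → refl })
  (λ { ([] , b) → refl ; (U ∷ R , b) → refl ; (D ∷ R , b) → refl })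

zeros : ∀ q → Vec ℕ q
zeros zero    = []
zeros (suc q) = 0 ∷ zeros q

sumV-zeros : ∀ q → sumV (zeros q) ≡ 0
sumV-zeros zero    = refl
sumV-zeros (suc q) = sumV-zeros q

Composition-0-unique : ∀ q (v : Composition 0 q) → v ≡ (zeros q , sumV-zeros q)
Composition-0-unique zero    ([] , refl) = refl
Composition-0-unique (suc q) (zero ∷ v , sum≡0) with Composition-0-unique q (v , sum≡0)
... | refl = refl

Composition↔multichoose : ∀ q s → Composition s q ↔ Fin (multichoose q s)
Composition↔multichoose zero    zero    = ↔Fin1 ([] , refl) (λ { ([] , refl) → refl })
Composition↔multichoose zero    (suc s) = ↔Fin0 (λ { ([] , ()) })
Composition↔multichoose (suc q) zero    = ↔Fin1 _ (Composition-0-unique (suc q))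
Composition↔multichoose (suc q) (suc s) =
  ↔-trans firstPart-cases (Composition↔multichoose (suc q) s ⊎-Fin Composition↔multichoose q (suc s))
  where
  firstPart-cases : Composition (suc s) (suc q) ↔ (Composition s (suc q) ⊎ Composition (suc s) q)
  firstPart-cases = mk↔ₛ′
    (λ { (zero ∷ v , eq) → inj₂ (v , eq) ; (suc x ∷ v , eq) → inj₁ (x ∷ v , suc-injective eq) })
    (λ { (inj₁ (x ∷ v , eq)) → suc x ∷ v , cong suc eq ; (inj₂ (v , eq)) → zero ∷ v , eq })
    (λ { (inj₁ (x ∷ v , eq)) → cong (λ e → inj₁ (x ∷ v , e)) (≡-irrelevant _ _)
       ; (inj₂ (v , eq)) → refl })
    (λ { (zero ∷ v , eq) → refl
       ; (suc x ∷ v , eq) → cong (λ e → (suc x ∷ v , e)) (≡-irrelevant _ _) })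

-- Reading a path backwards

reverse-∷-++ : ∀ {A : Set} (x : A) xs ys → reverse (x ∷ xs) ++ ys ≡ reverse xs ++ x ∷ ys
reverse-∷-++ x xs ys = trans (cong (_++ ys) (unfold-reverse x xs)) (++-assoc (reverse xs) [ x ] ys)

opposite : Step → Step
opposite U = D
opposite D = U

map-opposite-reverse-∷ : ∀ x xs → map opposite (reverse (x ∷ xs)) ≡ map opposite (reverse xs) ++ [ opposite x ]
map-opposite-reverse-∷ x xs = trans (cong (map opposite) (unfold-reverse x xs)) (map-++ opposite (reverse xs) [ x ])

-- dyckFrom with a free end height, so that reversal, which swaps the two ends, can be stated
reaches : ℕ → ℕ → List Step → Bool
reaches h       t []      = h ≡ᵇ t
reaches h       t (U ∷ s) = reaches (suc h) t s
reaches zero    t (D ∷ s) = false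
reaches (suc h) t (D ∷ s) = reaches h t s

dyckFrom≡reaches : ∀ h s → dyckFrom h s ≡ reaches h 0 s
dyckFrom≡reaches zero    []      = refl
dyckFrom≡reaches (suc h) []      = refl
dyckFrom≡reaches zero    (U ∷ s) = dyckFrom≡reaches 1 s
dyckFrom≡reaches (suc h) (U ∷ s) = dyckFrom≡reaches (suc (suc h)) s
dyckFrom≡reaches zero    (D ∷ s) = refl
dyckFrom≡reaches (suc h) (D ∷ s) = dyckFrom≡reaches h s

reaches-∷ʳD : ∀ h t s → reaches h t (s ++ [ D ]) ≡ reaches h (suc t) s
reaches-∷ʳD zero    t []      = refl
reaches-∷ʳD (suc h) t []      = refl
reaches-∷ʳD h       t (U ∷ s) = reaches-∷ʳD (suc h) t s
reaches-∷ʳD zero    t (D ∷ s) = refl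
reaches-∷ʳD (suc h) t (D ∷ s) = reaches-∷ʳD h t s

reaches0-∷ʳU : ∀ h s → reaches h 0 (s ++ [ U ]) ≡ false
reaches0-∷ʳU h       []      = refl
reaches0-∷ʳU h       (U ∷ s) = reaches0-∷ʳU (suc h) s
reaches0-∷ʳU zero    (D ∷ s) = refl
reaches0-∷ʳU (suc h) (D ∷ s) = reaches0-∷ʳU h s

reaches-∷ʳU : ∀ h t s → reaches h (suc t) (s ++ [ U ]) ≡ reaches h t s
reaches-∷ʳU h       t []      = refl
reaches-∷ʳU h       t (U ∷ s) = reaches-∷ʳU (suc h) t s
reaches-∷ʳU zero    t (D ∷ s) = refl
reaches-∷ʳU (suc h) t (D ∷ s) = reaches-∷ʳU h t s

≡ᵇ-sym : ∀ m n → (m ≡ᵇ n) ≡ (n ≡ᵇ m)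
≡ᵇ-sym zero    zero    = refl
≡ᵇ-sym zero    (suc n) = refl
≡ᵇ-sym (suc m) zero    = refl
≡ᵇ-sym (suc m) (suc n) = ≡ᵇ-sym m n

reaches-reverse : ∀ s h t → reaches h t s ≡ reaches t h (map opposite (reverse s))
reaches-reverse []      h       t = ≡ᵇ-sym h t
reaches-reverse (U ∷ s) h       t = trans (reaches-reverse s (suc h) t)
  (sym (trans (cong (reaches t h) (map-opposite-reverse-∷ U s)) (reaches-∷ʳD t h (map opposite (reverse s)))))
reaches-reverse (D ∷ s) zero    t =
  sym (trans (cong (reaches t 0) (map-opposite-reverse-∷ D s)) (reaches0-∷ʳU t (map opposite (reverse s))))
reaches-reverse (D ∷ s) (suc h) t = trans (reaches-reverse s h t)
  (sym (trans (cong (reaches t (suc h)) (map-opposite-reverse-∷ D s)) (reaches-∷ʳU t h (map opposite (reverse s)))))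

isDyck-reverse : ∀ P → isDyck P ≡ isDyck (map opposite (reverse P))
isDyck-reverse P = begin
  dyckFrom 0 P                                ≡⟨ dyckFrom≡reaches 0 P ⟩
  reaches 0 0 P                               ≡⟨ reaches-reverse P 0 0 ⟩
  reaches 0 0 (map opposite (reverse P))      ≡⟨ sym (dyckFrom≡reaches 0 (map opposite (reverse P))) ⟩
  dyckFrom 0 (map opposite (reverse P))       ∎
  where open ≡-Reasoning

semilength-++ : ∀ xs ys → semilength (xs ++ ys) ≡ semilength xs + semilength ys
semilength-++ []       ys = refl
semilength-++ (U ∷ xs) ys = cong suc (semilength-++ xs ys)
semilength-++ (D ∷ xs) ys = semilength-++ xs ys

semilength-reverse : ∀ P → semilength (reverse P) ≡ semilength P
semilength-reverse []      = refl
semilength-reverse (x ∷ P) = begin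
  semilength (reverse (x ∷ P))               ≡⟨ cong semilength (unfold-reverse x P) ⟩
  semilength (reverse P ++ [ x ])            ≡⟨ semilength-++ (reverse P) [ x ] ⟩
  semilength (reverse P) + semilength [ x ]  ≡⟨ cong (_+ semilength [ x ]) (semilength-reverse P) ⟩
  semilength P + semilength [ x ]            ≡⟨ +-comm (semilength P) _ ⟩
  semilength [ x ] + semilength P            ≡⟨ semilength-++ [ x ] P ⟨
  semilength (x ∷ P)                         ∎
  where open ≡-Reasoning

-- uuAfter b s counts the instances of UU in s, preceded by an up step iff b
uuAfter : Bool → List Step → ℕ
uuAfter _     []      = 0
uuAfter _     (D ∷ s) = uuAfter false s
uuAfter false (U ∷ s) = uuAfter true s
uuAfter true  (U ∷ s) = suc (uuAfter true s)

countUU≡uuAfter : ∀ s → countUU s ≡ uuAfter false s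
countUU≡uuAfter []      = refl
countUU≡uuAfter (U ∷ s) = countUU[U∷]≡uuAfter s
  where
  countUU[U∷]≡uuAfter : ∀ s → countUU (U ∷ s) ≡ uuAfter true s
  countUU[U∷]≡uuAfter []      = refl
  countUU[U∷]≡uuAfter (U ∷ s) = cong suc (countUU[U∷]≡uuAfter s)
  countUU[U∷]≡uuAfter (D ∷ s) = countUU≡uuAfter s
countUU≡uuAfter (D ∷ s) = countUU≡uuAfter s

endsUp : Bool → List Step → Bool
endsUp b []       = b
endsUp _ (U ∷ xs) = endsUp true xs
endsUp _ (D ∷ xs) = endsUp false xs

uuAfter-++ : ∀ b xs ys → uuAfter b (xs ++ ys) ≡ uuAfter b xs + uuAfter (endsUp b xs) ys
uuAfter-++ b     []       ys = refl
uuAfter-++ b     (D ∷ xs) ys = uuAfter-++ false xs ys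
uuAfter-++ false (U ∷ xs) ys = uuAfter-++ true xs ys
uuAfter-++ true  (U ∷ xs) ys = cong suc (uuAfter-++ true xs ys)

upIf : Bool → List Step
upIf false = []
upIf true  = [ U ]

uuAfter-reverse : ∀ s b → uuAfter false (reverse s ++ upIf b) ≡ uuAfter b s
uuAfter-reverse []      false = refl
uuAfter-reverse []      true  = refl
uuAfter-reverse (x ∷ s) b     = begin
  uuAfter false (reverse (x ∷ s) ++ upIf b)         ≡⟨ cong (uuAfter false) (reverse-∷-++ x s (upIf b)) ⟩
  uuAfter false (reverse s ++ x ∷ upIf b)           ≡⟨ uuAfter-++ false (reverse s) (x ∷ upIf b) ⟩
  n + uuAfter ℓ (x ∷ upIf b)                        ≡⟨ cong (n +_) (split ℓ x b) ⟩
  n + (uuAfter ℓ (upIf u) + uuAfter b [ x ])        ≡⟨ +-assoc n _ _ ⟨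
  n + uuAfter ℓ (upIf u) + uuAfter b [ x ]          ≡⟨ cong (_+ uuAfter b [ x ]) (uuAfter-++ false (reverse s) (upIf u)) ⟨
  uuAfter false (reverse s ++ upIf u) + uuAfter b [ x ] ≡⟨ cong (_+ uuAfter b [ x ]) (uuAfter-reverse s u) ⟩
  uuAfter u s + uuAfter b [ x ]                     ≡⟨ +-comm (uuAfter u s) _ ⟩
  uuAfter b [ x ] + uuAfter u s                     ≡⟨ uuAfter-++ b [ x ] s ⟨
  uuAfter b (x ∷ s)                                 ∎
  where
  open ≡-Reasoning
  n = uuAfter false (reverse s)
  ℓ = endsUp false (reverse s)
  u = endsUp b [ x ]
  split : ∀ ℓ x b → uuAfter ℓ (x ∷ upIf b) ≡ uuAfter ℓ (upIf (endsUp b [ x ])) + uuAfter b [ x ]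
  split false U false = refl
  split false U true  = refl
  split true  U false = refl
  split true  U true  = refl
  split ℓ     D false = refl
  split ℓ     D true  = refl

countUU-reverse : ∀ P → countUU P ≡ uuAfter false (reverse P)
countUU-reverse P = begin
  countUU P                                  ≡⟨ countUU≡uuAfter P ⟩
  uuAfter false P                            ≡⟨ cong (uuAfter false) (trans (++-identityʳ _) (reverse-involutive P)) ⟨
  uuAfter false (reverse (reverse P) ++ [])  ≡⟨ uuAfter-reverse (reverse P) false ⟩
  uuAfter false (reverse P)                  ∎
  where open ≡-Reasoning

descentsFrom-++-U∷ : ∀ c xs ys → descentsFrom c (xs ++ U ∷ ys) ≡ descentsFrom c xs ++ descentsFrom 0 ys
descentsFrom-++-U∷ zero    []       ys = refl
descentsFrom-++-U∷ (suc c) []       ys = refl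
descentsFrom-++-U∷ c       (D ∷ xs) ys = descentsFrom-++-U∷ (suc c) xs ys
descentsFrom-++-U∷ zero    (U ∷ xs) ys = descentsFrom-++-U∷ 0 xs ys
descentsFrom-++-U∷ (suc c) (U ∷ xs) ys = cong (suc c ∷_) (descentsFrom-++-U∷ 0 xs ys)

descentsFrom-replicate : ∀ a c → descentsFrom a (replicate c D) ≡ descentsFrom (c + a) []
descentsFrom-replicate a zero    = refl
descentsFrom-replicate a (suc c) =
  trans (descentsFrom-replicate (suc a) c) (cong (λ m → descentsFrom m []) (+-suc c a))

descents-replicate : ∀ c → descents (replicate c D) ≡ descentsFrom c []
descents-replicate c = trans (descentsFrom-replicate 0 c) (cong (λ m → descentsFrom m []) (+-identityʳ c))

descents-reverse-++ : ∀ s c → descents (reverse s ++ replicate c D) ≡ reverse (descentsFrom c s)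
descents-reverse-++ []      zero    = refl
descents-reverse-++ []      (suc c) = descents-replicate (suc c)
descents-reverse-++ (D ∷ s) c       =
  trans (cong descents (reverse-∷-++ D s (replicate c D))) (descents-reverse-++ s (suc c))
descents-reverse-++ (U ∷ s) c       = begin
  descents (reverse (U ∷ s) ++ replicate c D)          ≡⟨ cong descents (reverse-∷-++ U s (replicate c D)) ⟩
  descents (reverse s ++ U ∷ replicate c D)            ≡⟨ descentsFrom-++-U∷ 0 (reverse s) (replicate c D) ⟩
  descents (reverse s) ++ descents (replicate c D)     ≡⟨ cong₂ _++_ reversed (descents-replicate c) ⟩
  reverse (descents s) ++ descentsFrom c []            ≡⟨ closeRun c ⟩
  reverse (descentsFrom c (U ∷ s))                     ∎
  where
  open ≡-Reasoning
  reversed : descents (reverse s) ≡ reverse (descents s)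
  reversed = trans (cong descents (sym (++-identityʳ (reverse s)))) (descents-reverse-++ s 0)
  closeRun : ∀ c → reverse (descents s) ++ descentsFrom c [] ≡ reverse (descentsFrom c (U ∷ s))
  closeRun zero    = ++-identityʳ _
  closeRun (suc c) = sym (unfold-reverse (suc c) (descents s))

descents-reverse : ∀ P → descents P ≡ reverse (descents (reverse P))
descents-reverse P = begin
  descents P                                  ≡⟨ cong descents (trans (++-identityʳ _) (reverse-involutive P)) ⟨
  descents (reverse (reverse P) ++ [])        ≡⟨ descents-reverse-++ (reverse P) 0 ⟩
  reverse (descents (reverse P))              ∎
  where open ≡-Reasoning

-- Labelling p false labels a list of descent lengths read backwards (the last descent of the
-- path comes first and stays unlabelled); Labelling p true labels every descent
Labelling : ℕ → Bool → List ℕ → Set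
Labelling p _     []       = ⊤
Labelling p false (_ ∷ ℓs) = Labelling p true ℓs
Labelling p true  (ℓ ∷ ℓs) = Composition (ℓ ∸ 1) p × Labelling p true ℓs

Labels-∷ʳ : ∀ p ℓs ℓ → Labels (suc p) (ℓs ++ [ ℓ ]) ↔ Labelling p true ℓs
Labels-∷ʳ p []             ℓ = ↔-refl
Labels-∷ʳ p (ℓ′ ∷ [])      ℓ = ↔-refl
Labels-∷ʳ p (ℓ′ ∷ ℓ″ ∷ ℓs) ℓ = ↔-refl ×-↔ Labels-∷ʳ p (ℓ″ ∷ ℓs) ℓ

Labelling-++ : ∀ p xs ys → Labelling p true (xs ++ ys) ↔ (Labelling p true xs × Labelling p true ys)
Labelling-++ p []       ys = mk↔ₛ′ (λ l → tt , l) proj₂ (λ _ → refl) (λ _ → refl)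
Labelling-++ p (x ∷ xs) ys = ↔-trans (↔-refl ×-↔ Labelling-++ p xs ys)
  (mk↔ₛ′ (λ { (a , b , c) → (a , b) , c }) (λ { ((a , b) , c) → a , b , c }) (λ _ → refl) (λ _ → refl))

Labelling-reverse : ∀ p ℓs → Labelling p true (reverse ℓs) ↔ Labelling p true ℓs
Labelling-reverse p []       = ↔-refl
Labelling-reverse p (ℓ ∷ ℓs) =
  ↔-trans (≡⇒↔ (cong (Labelling p true) (unfold-reverse ℓ ℓs)))
  (↔-trans (Labelling-++ p (reverse ℓs) [ ℓ ])
  (↔-trans (Labelling-reverse p ℓs ×-↔ ↔-refl)
           (mk↔ₛ′ (λ { (l , c , tt) → c , l }) (λ { (c , l) → l , c , tt }) (λ _ → refl) (λ _ → refl))))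

Labels-reverse : ∀ p ℓs → Labels (suc p) (reverse ℓs) ↔ Labelling p false ℓs
Labels-reverse p []       = ↔-refl
Labels-reverse p (ℓ ∷ ℓs) =
  ↔-trans (≡⇒↔ (cong (Labels (suc p)) (unfold-reverse ℓ ℓs)))
  (↔-trans (Labels-∷ʳ p (reverse ℓs) ℓ) (Labelling-reverse p ℓs))

-- The transfer recursion

×-pull-weight : {A A′ B B′ C C′ L L′ W : Set} → A ↔ A′ → B ↔ B′ → C ↔ C′ → L ↔ (W × L′) →
                (A × B × C × L) ↔ (W × (A′ × B′ × C′ × L′))
×-pull-weight a b c l = ↔-trans (a ×-↔ (b ×-↔ (c ×-↔ l)))
  (mk↔ₛ′ (λ { (a , b , c , w , l) → w , a , b , c , l }) (λ { (w , a , b , c , l) → a , b , c , w , l })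
         (λ _ → refl) (λ _ → refl))

Σ-pull : {I W : Set} {A : I → Set} → Σ I (λ x → W × A x) ↔ (W × Σ I A)
Σ-pull = mk↔ₛ′ (λ { (x , w , a) → w , x , a }) (λ { (w , x , a) → x , w , a }) (λ _ → refl) (λ _ → refl)

downs : List Step → ℕ
downs []      = 0
downs (U ∷ s) = downs s
downs (D ∷ s) = suc (downs s)

downs-map-opposite : ∀ s → downs (map opposite s) ≡ semilength s
downs-map-opposite []      = refl
downs-map-opposite (U ∷ s) = cong suc (downs-map-opposite s)
downs-map-opposite (D ∷ s) = downs-map-opposite s

dyckFrom⇒≤downs : ∀ h s → T (dyckFrom h s) → h ≤ downs s
dyckFrom⇒≤downs zero    s       _ = z≤n
dyckFrom⇒≤downs (suc h) (U ∷ s) t = ≤-trans (n≤1+n _) (dyckFrom⇒≤downs (suc (suc h)) s t)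
dyckFrom⇒≤downs (suc h) (D ∷ s) t = s≤s (dyckFrom⇒≤downs h s t)

dyckFrom-U∷ : ∀ h s → dyckFrom h (U ∷ s) ≡ dyckFrom (suc h) s
dyckFrom-U∷ zero    s = refl
dyckFrom-U∷ (suc h) s = refl

module _ (p : ℕ) where

  -- A labelled path is read backwards, as the reversed path R.  Tails h c u l r k R says that
  -- R completes a reading that has reached height h of the opposite path, sits at the end of
  -- a run of c down steps, has just read an up step iff u, and labels descents iff l; the
  -- remaining semilength is r and k instances of UU are still to come.
  Tails : ℕ → ℕ → Bool → Bool → ℕ → ℕ → List Step → Set
  Tails h c u l r k R =
    T (dyckFrom h (map opposite R)) × semilength R ≡ r × uuAfter u R ≡ k × Labelling p l (descentsFrom c R)

  LabelledPaths↔Tails : ∀ m k → LabelledPaths (suc p) m k ↔ Σ (List Step) (Tails 0 0 false false m k)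
  LabelledPaths↔Tails m k = Σ-↔ reverse↔ (λ {P} → reversed P)
    where
    reverse↔ : List Step ↔ List Step
    reverse↔ = mk↔ₛ′ reverse reverse reverse-involutive reverse-involutive
    reversed : ∀ P → (T (isDyck P) × semilength P ≡ m × countUU P ≡ k × Labels (suc p) (descents P)) ↔
                     Tails 0 0 false false m k (reverse P)
    reversed P =
      ≡⇒↔ (cong T (isDyck-reverse P)) ×-↔
      (≡⇒↔ (cong (_≡ m) (sym (semilength-reverse P))) ×-↔
      (≡⇒↔ (cong (_≡ k) (countUU-reverse P)) ×-↔
      ↔-trans (≡⇒↔ (cong (Labels (suc p)) (descents-reverse P))) (Labels-reverse p (descents (reverse P)))))

  -- the number of labels of a descent of length c, which is closed by the next up step
  runWeight : ℕ → Bool → ℕ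
  runWeight zero    _     = 1
  runWeight (suc c) false = 1
  runWeight (suc c) true  = multichoose p c

  labelledAfter : ℕ → Bool → Bool
  labelledAfter zero    l = l
  labelledAfter (suc _) _ = true

  Labelling-U∷ : ∀ c l R → Labelling p l (descentsFrom c (U ∷ R)) ↔
                 (Fin (runWeight c l) × Labelling p (labelledAfter c l) (descents R))
  Labelling-U∷ zero    l     R = Fin1×↔
  Labelling-U∷ (suc c) false R = Fin1×↔
  Labelling-U∷ (suc c) true  R = Composition↔multichoose p c ×-↔ ↔-refl

  -- g counts the down steps of R still to come, so that the remaining semilength is h + g
  emptyCount : ℕ → ℕ → ℕ → Bool → ℕ → ℕ
  emptyCount zero zero c l zero = runWeight c l
  emptyCount _    _    _ _ _    = 0

  mutual
    count : ℕ → ℕ → ℕ → Bool → Bool → ℕ → ℕ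
    count g h c u l k = emptyCount g h c l k + (countU g h c u l k + countD g h c u l k)

    countU : ℕ → ℕ → ℕ → Bool → Bool → ℕ → ℕ
    countU g zero    c u     l k       = 0
    countU g (suc h) c false l k       = runWeight c l * count g h 0 true (labelledAfter c l) k
    countU g (suc h) c true  l zero    = 0
    countU g (suc h) c true  l (suc k) = runWeight c l * count g h 0 true (labelledAfter c l) k

    countD : ℕ → ℕ → ℕ → Bool → Bool → ℕ → ℕ
    countD zero    h c u l k = 0
    countD (suc g) h c u l k = count g (suc h) (suc c) false l k

  Tails-[]↔ : ∀ g h c u l k → Tails h c u l (h + g) k [] ↔ Fin (emptyCount g h c l k)
  Tails-[]↔ zero    zero    zero    u l     zero    = ↔Fin1 _ (λ { (tt , refl , refl , tt) → refl })
  Tails-[]↔ zero    zero    (suc c) u false zero    = ↔Fin1 _ (λ { (tt , refl , refl , tt) → refl })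
  Tails-[]↔ zero    zero    (suc c) u true  zero    = ↔-trans
    (mk↔ₛ′ (λ { (_ , _ , _ , x , _) → x }) (λ x → tt , refl , refl , x , tt)
           (λ _ → refl) (λ { (tt , refl , refl , x , tt) → refl }))
    (Composition↔multichoose p c)
  Tails-[]↔ zero    zero    c       u l     (suc k) = ↔Fin0 (λ { (_ , _ , () , _) })
  Tails-[]↔ (suc g) zero    c       u l     k       = ↔Fin0 (λ { (_ , () , _) })
  Tails-[]↔ zero    (suc h) c       u l     k       = ↔Fin0 (λ { (() , _) })
  Tails-[]↔ (suc g) (suc h) c       u l     k       = ↔Fin0 (λ { (() , _) })

  mutual
    Tails↔count : ∀ g h c u l k → Σ (List Step) (Tails h c u l (h + g) k) ↔ Fin (count g h c u l k)
    Tails↔count g h c u l k =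
      ↔-trans List-Step-cases↔
              (Tails-[]↔ g h c u l k ⊎-Fin (Tails-U∷↔ g h c u l k ⊎-Fin Tails-D∷↔ g h c u l k))

    Tails-U∷↔ : ∀ g h c u l k →
      Σ (List Step) (λ R → Tails h c u l (h + g) k (U ∷ R)) ↔ Fin (countU g h c u l k)
    Tails-U∷↔ g zero    c u     l k       = ↔Fin0 (λ { (R , () , _) })
    Tails-U∷↔ g (suc h) c false l k       =
      ↔-trans (Σ-congʳ (λ R → ×-pull-weight ↔-refl suc≡suc↔ ↔-refl (Labelling-U∷ c l R)))
              (↔-trans Σ-pull (↔-refl ×-Fin Tails↔count g h 0 true (labelledAfter c l) k))
    Tails-U∷↔ g (suc h) c true  l zero    = ↔Fin0 (λ { (R , _ , _ , () , _) })
    Tails-U∷↔ g (suc h) c true  l (suc k) =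
      ↔-trans (Σ-congʳ (λ R → ×-pull-weight ↔-refl suc≡suc↔ suc≡suc↔ (Labelling-U∷ c l R)))
              (↔-trans Σ-pull (↔-refl ×-Fin Tails↔count g h 0 true (labelledAfter c l) k))

    Tails-D∷↔ : ∀ g h c u l k →
      Σ (List Step) (λ R → Tails h c u l (h + g) k (D ∷ R)) ↔ Fin (countD g h c u l k)
    -- with g = 0 the opposite path has only h down steps left, too few after one more up step
    Tails-D∷↔ zero    h c u l k = ↔Fin0 (λ { (R , t , len , _) → <-irrefl refl (≤-trans
      (dyckFrom⇒≤downs (suc h) (map opposite R) (subst T (dyckFrom-U∷ h (map opposite R)) t))
      (≤-reflexive (trans (downs-map-opposite R) (trans len (+-identityʳ h))))) })
    Tails-D∷↔ (suc g) h c u l k =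
      ↔-trans (Σ-congʳ (λ R → ≡⇒↔ (cong T (dyckFrom-U∷ h (map opposite R)))
                              ×-↔ (≡⇒↔ (cong (semilength R ≡_) (+-suc h g)) ×-↔ ↔-refl)))
              (Tails↔count g (suc h) (suc c) false l k)

  pathCount : ℕ → ℕ → ℕ
  pathCount m k = count m 0 0 false false k

  LabelledPaths↔pathCount : ∀ m k → LabelledPaths (suc p) m k ↔ Fin (pathCount m k)
  LabelledPaths↔pathCount m k = ↔-trans (LabelledPaths↔Tails m k) (Tails↔count m 0 0 false false k)

  -- Closed forms

  -- count at the states reached by an up step, and inside a run of c + 1 down steps
  afterUp : ℕ → ℕ → ℕ → ℕ
  afterUp g h k = count g h 0 true true k

  mutual
    inRun : Bool → ℕ → ℕ → ℕ → ℕ → ℕ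
    inRun l g h c k = runWeight (suc c) l * afterUp g h k + inRunD l g h c k

    inRunD : Bool → ℕ → ℕ → ℕ → ℕ → ℕ
    inRunD l zero    h c k = 0
    inRunD l (suc g) h c k = inRun l g (suc h) (suc c) k

  count≡inRun : ∀ l g h c k → count g (suc h) (suc c) false l k ≡ inRun l g h c k
  count≡inRun l zero    h c k = refl
  count≡inRun l (suc g) h c k =
    cong (runWeight (suc c) l * afterUp (suc g) h k +_) (count≡inRun l g (suc h) (suc c) k)

  afterUpU : ℕ → ℕ → ℕ → ℕ
  afterUpU g zero    k       = 0
  afterUpU g (suc h) zero    = 0
  afterUpU g (suc h) (suc k) = afterUp g h k

  afterUpD : ℕ → ℕ → ℕ → ℕ
  afterUpD zero    h k = 0
  afterUpD (suc g) h k = inRun true g h 0 k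

  afterUp-unfold : ∀ g h k → afterUp g h k ≡ emptyCount g h 0 true k + (afterUpU g h k + afterUpD g h k)
  afterUp-unfold zero    zero    k       = refl
  afterUp-unfold zero    (suc h) zero    = refl
  afterUp-unfold zero    (suc h) (suc k) =
    cong (λ n → emptyCount zero (suc h) 0 true (suc k) + (n + 0)) (*-identityˡ (afterUp zero h k))
  afterUp-unfold (suc g) zero    k       =
    cong (λ n → emptyCount (suc g) zero 0 true k + (0 + n)) (count≡inRun true g 0 0 k)
  afterUp-unfold (suc g) (suc h) zero    =
    cong (λ n → emptyCount (suc g) (suc h) 0 true zero + (0 + n)) (count≡inRun true g (suc h) 0 zero)
  afterUp-unfold (suc g) (suc h) (suc k) =
    cong₂ (λ m n → emptyCount (suc g) (suc h) 0 true (suc k) + (m + n))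
          (*-identityˡ (afterUp (suc g) h k)) (count≡inRun true g (suc h) 0 (suc k))

  mutual
    k<h⇒afterUp≡0 : ∀ g h k → k < h → afterUp g h k ≡ 0
    k<h⇒afterUp≡0 g (suc h) k k<h = begin
      afterUp g (suc h) k                   ≡⟨ afterUp-unfold g (suc h) k ⟩
      emptyCount g (suc h) 0 true k + (afterUpU g (suc h) k + afterUpD g (suc h) k)
        ≡⟨ cong₂ (λ m n → m + (n + afterUpD g (suc h) k)) (noEmpty g) (noU k k<h) ⟩
      0 + (0 + afterUpD g (suc h) k)        ≡⟨ noD g ⟩
      0                                     ∎
      where
      open ≡-Reasoning
      noEmpty : ∀ g → emptyCount g (suc h) 0 true k ≡ 0
      noEmpty zero    = refl
      noEmpty (suc g) = refl
      noU : ∀ k → k < suc h → afterUpU g (suc h) k ≡ 0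
      noU zero    _         = refl
      noU (suc k) (s≤s k<h) = k<h⇒afterUp≡0 g h k k<h
      noD : ∀ g → 0 + (0 + afterUpD g (suc h) k) ≡ 0
      noD zero    = refl
      noD (suc g) = k<h⇒inRun≡0 true g (suc h) 0 k k<h

    k<h⇒inRun≡0 : ∀ l g h c k → k < h → inRun l g h c k ≡ 0
    k<h⇒inRun≡0 l g h c k k<h =
      cong₂ _+_ (trans (cong (runWeight (suc c) l *_) (k<h⇒afterUp≡0 g h k k<h)) (*-zeroʳ (runWeight (suc c) l)))
                (noD g)
      where
      noD : ∀ g → inRunD l g h c k ≡ 0
      noD zero    = refl
      noD (suc g) = k<h⇒inRun≡0 l g (suc h) (suc c) k (≤-trans k<h (n≤1+n _))

  mutual
    g+h<k⇒afterUp≡0 : ∀ g h k → g + h < k → afterUp g h k ≡ 0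
    g+h<k⇒afterUp≡0 g h (suc k) g+h<k = begin
      afterUp g h (suc k)                   ≡⟨ afterUp-unfold g h (suc k) ⟩
      emptyCount g h 0 true (suc k) + (afterUpU g h (suc k) + afterUpD g h (suc k))
        ≡⟨ cong₂ (λ m n → m + (n + afterUpD g h (suc k))) (noEmpty g h) (noU h g+h<k) ⟩
      0 + (0 + afterUpD g h (suc k))        ≡⟨ noD g g+h<k ⟩
      0                                     ∎
      where
      open ≡-Reasoning
      noEmpty : ∀ g h → emptyCount g h 0 true (suc k) ≡ 0
      noEmpty zero    zero    = refl
      noEmpty zero    (suc h) = refl
      noEmpty (suc g) h       = refl
      noU : ∀ h → g + h < suc k → afterUpU g h (suc k) ≡ 0
      noU zero    _     = refl
      noU (suc h) g+h<k = g+h<k⇒afterUp≡0 g h k (≤-pred (subst (_< suc k) (+-suc g h) g+h<k))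
      noD : ∀ g → g + h < suc k → 0 + (0 + afterUpD g h (suc k)) ≡ 0
      noD zero    _     = refl
      noD (suc g) g+h<k = g+h<k⇒inRun≡0 true g h 0 (suc k) (≤-trans (n≤1+n _) g+h<k)

    g+h<k⇒inRun≡0 : ∀ l g h c k → g + h < k → inRun l g h c k ≡ 0
    g+h<k⇒inRun≡0 l g h c k g+h<k =
      cong₂ _+_ (trans (cong (runWeight (suc c) l *_) (g+h<k⇒afterUp≡0 g h k g+h<k)) (*-zeroʳ (runWeight (suc c) l)))
                (noD g g+h<k)
      where
      noD : ∀ g → g + h < k → inRunD l g h c k ≡ 0
      noD zero    _     = refl
      noD (suc g) g+h<k = g+h<k⇒inRun≡0 l g (suc h) (suc c) k (subst (_< k) (sym (+-suc g h)) g+h<k)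

  afterUp[0,h,h]≡1 : ∀ h → afterUp 0 h h ≡ 1
  afterUp[0,h,h]≡1 zero    = refl
  afterUp[0,h,h]≡1 (suc h) = trans (afterUp-unfold 0 (suc h) (suc h)) (trans (+-identityʳ _) (afterUp[0,h,h]≡1 h))

  afterUp[1+L,h,h+1+L]≡0 : ∀ L h → afterUp (suc L) h (h + suc L) ≡ 0
  afterUp[1+L,h,h+1+L]≡0 L h =
    trans (afterUp-unfold (suc L) h (h + suc L))
          (cong (0 +_) (cong₂ _+_ (noU h) (g+h<k⇒inRun≡0 true L h 0 (h + suc L) L+h<h+1+L)))
    where
    noU : ∀ h → afterUpU (suc L) h (h + suc L) ≡ 0
    noU zero    = refl
    noU (suc h) = afterUp[1+L,h,h+1+L]≡0 L h
    L+h<h+1+L : L + h < h + suc L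
    L+h<h+1+L = ≤-reflexive (trans (cong suc (+-comm L h)) (sym (+-suc h L)))

  runSum : Bool → ℕ → ℕ → ℕ → ℕ → ℕ
  runSum l b c h L = convolution (λ x → runWeight (suc (c + x)) l * suc (h + x)) (multichoose (b * p)) L

  runSum-labelled : ∀ b h L → suc b * runSum true b 0 h L ≡ (suc b * suc h + L) * multichoose (suc b * p) L
  runSum-labelled b h L = begin
    suc b * runSum true b 0 h L
      ≡⟨ cong (suc b *_) (convolution-congˡ M L (λ x → split (multichoose p x) h x)) ⟩
    suc b * convolution (λ x → suc h * multichoose p x + x * multichoose p x) M L
      ≡⟨ cong (suc b *_) (convolution-distribʳ-+ (λ x → suc h * multichoose p x) _ M L) ⟩
    suc b * (convolution (λ x → suc h * multichoose p x) M L + weighted)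
      ≡⟨ cong (λ n → suc b * (n + weighted)) (convolution-scaleˡ (suc h) (multichoose p) M L) ⟩
    suc b * (suc h * convolution (multichoose p) M L + weighted)
      ≡⟨ cong (λ n → suc b * (suc h * n + weighted)) (multichoose-vandermonde p (b * p) L) ⟩
    suc b * (suc h * M′ + weighted)
      ≡⟨ *-distribˡ-+ (suc b) (suc h * M′) weighted ⟩
    suc b * (suc h * M′) + suc b * weighted
      ≡⟨ cong (suc b * (suc h * M′) +_) (multichoose-vandermonde-weighted p b L) ⟩
    suc b * (suc h * M′) + L * M′
      ≡⟨ collect (suc b) (suc h) L M′ ⟩
    (suc b * suc h + L) * M′ ∎
    where
    open ≡-Reasoning
    M = multichoose (b * p)
    M′ = multichoose (suc b * p) L
    weighted = convolution (λ x → x * multichoose p x) M L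
    split : ∀ m h x → m * suc (h + x) ≡ suc h * m + x * m
    split = solve-∀
    collect : ∀ a h L M → a * (h * M) + L * M ≡ (a * h + L) * M
    collect = solve-∀

  runSum-unlabelled : ∀ a k → runSum false a 0 0 k ≡ multichoose (2 + a * p) k
  runSum-unlabelled a k =
    trans (convolution-congˡ (multichoose (a * p)) k (λ x → trans (*-identityˡ (suc x)) (sym (multichoose-2ˡ x))))
          (multichoose-vandermonde 2 (a * p) k)

  -- indexing by g = L + a and k = h + L keeps the closed forms free of truncated subtraction
  AfterUpClosed : ℕ → ℕ → ℕ → Set
  AfterUpClosed a L h =
    suc (L + a + h) * afterUp (L + a) h (h + L) ≡ suc h * multichoose (2 + (h + L)) a * multichoose (a * p) L

  inRun-closed : ∀ l b → (∀ L h → AfterUpClosed b L h) → ∀ L h c →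
    suc (L + b + h) * inRun l (L + b) h c (h + L) ≡ multichoose (2 + (h + L)) b * runSum l b c h L
  inRun-closed l b afterUp-closedᵇ zero h c = begin
    suc (b + h) * (w * A + inRunD l b h c (h + 0)) ≡⟨ cong (λ n → suc (b + h) * (w * A + n)) (noD b) ⟩
    suc (b + h) * (w * A + 0)                     ≡⟨ ring₁ (b + h) w A ⟩
    w * (suc (b + h) * A)                         ≡⟨ cong (w *_) (afterUp-closedᵇ 0 h) ⟩
    w * (suc h * K * 1)                           ≡⟨ ring₂ w h K ⟩
    K * (w * suc h * 1)                           ≡⟨ cong₂ (λ x y → K * (runWeight (suc x) l * suc y * 1))
                                                           (sym (+-identityʳ c)) (sym (+-identityʳ h)) ⟩
    K * (runWeight (suc (c + 0)) l * suc (h + 0) * 1) ∎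
    where
    open ≡-Reasoning
    w = runWeight (suc c) l
    A = afterUp b h (h + 0)
    K = multichoose (2 + (h + 0)) b
    noD : ∀ b → inRunD l b h c (h + 0) ≡ 0
    noD zero    = refl
    noD (suc b) = k<h⇒inRun≡0 l b (suc h) (suc c) (h + 0) (s≤s (≤-reflexive (+-identityʳ h)))
    ring₁ : ∀ n w A → suc n * (w * A + 0) ≡ w * (suc n * A)
    ring₁ = solve-∀
    ring₂ : ∀ w h K → w * (suc h * K * 1) ≡ K * (w * suc h * 1)
    ring₂ = solve-∀
  inRun-closed l b afterUp-closedᵇ (suc L) h c = begin
    n * (w * A + R)                   ≡⟨ ring₁ n w A R ⟩
    w * (n * A) + n * R               ≡⟨ cong₂ _+_ (cong (w *_) (afterUp-closedᵇ (suc L) h)) rest ⟩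
    w * (suc h * K * M) + K * S       ≡⟨ ring₂ w h K M S ⟩
    K * (w * suc h * M + S)           ≡⟨ cong₂ (λ x y → K * (runWeight (suc x) l * suc y * M + S))
                                               (sym (+-identityʳ c)) (sym (+-identityʳ h)) ⟩
    K * (runWeight (suc (c + 0)) l * suc (h + 0) * M + S) ∎
    where
    open ≡-Reasoning
    n = suc (suc L + b + h)
    w = runWeight (suc c) l
    A = afterUp (suc (L + b)) h (h + suc L)
    R = inRun l (L + b) (suc h) (suc c) (h + suc L)
    K = multichoose (2 + (h + suc L)) b
    M = multichoose (b * p) (suc L)
    S = convolution (λ x → runWeight (suc (c + suc x)) l * suc (h + suc x)) (multichoose (b * p)) L
    ring₁ : ∀ n w A R → n * (w * A + R) ≡ w * (n * A) + n * R
    ring₁ = solve-∀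
    ring₂ : ∀ w h K M S → w * (suc h * K * M) + K * S ≡ K * (w * suc h * M + S)
    ring₂ = solve-∀
    rest : n * R ≡ K * S
    rest = begin
      n * R
        ≡⟨ cong₂ _*_ (cong suc (sym (+-suc (L + b) h))) (cong (inRun l (L + b) (suc h) (suc c)) (+-suc h L)) ⟩
      suc (L + b + suc h) * inRun l (L + b) (suc h) (suc c) (suc h + L)
        ≡⟨ inRun-closed l b afterUp-closedᵇ L (suc h) (suc c) ⟩
      multichoose (2 + (suc h + L)) b * runSum l b (suc c) (suc h) L
        ≡⟨ cong₂ _*_ (cong (λ m → multichoose (2 + m) b) (sym (+-suc h L)))
                     (convolution-congˡ (multichoose (b * p)) L
                       (λ x → cong₂ (λ y z → runWeight (suc y) l * suc z) (sym (+-suc c x)) (sym (+-suc h x)))) ⟩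
      K * S ∎

  afterUp-closed : ∀ a L h → AfterUpClosed a L h
  afterUp-closed zero    zero    h = begin
    suc h * afterUp 0 h (h + 0)       ≡⟨ cong (λ m → suc h * afterUp 0 h m) (+-identityʳ h) ⟩
    suc h * afterUp 0 h h             ≡⟨ cong (suc h *_) (afterUp[0,h,h]≡1 h) ⟩
    suc h * 1                         ≡⟨ *-identityʳ (suc h * 1) ⟨
    suc h * 1 * 1                     ∎
    where open ≡-Reasoning
  afterUp-closed zero    (suc L) h = begin
    suc (suc L + 0 + h) * afterUp (suc L + 0) h (h + suc L)
      ≡⟨ cong (λ g → suc (suc L + 0 + h) * afterUp g h (h + suc L)) (+-identityʳ (suc L)) ⟩
    suc (suc L + 0 + h) * afterUp (suc L) h (h + suc L)
      ≡⟨ cong (suc (suc L + 0 + h) *_) (afterUp[1+L,h,h+1+L]≡0 L h) ⟩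
    suc (suc L + 0 + h) * 0
      ≡⟨ *-zeroʳ (suc (suc L + 0 + h)) ⟩
    0
      ≡⟨ *-zeroʳ (suc h * 1) ⟨
    suc h * 1 * 0 ∎
    where open ≡-Reasoning
  afterUp-closed (suc b) L = closed
    where
    M = multichoose (suc b * p) L
    closed : ∀ h → AfterUpClosed (suc b) L h
    closed h = begin
      suc (L + suc b + h) * afterUp (L + suc b) h (h + L)
        ≡⟨ cong₂ _*_ (cong suc (sym n≡)) (cong (λ g → afterUp g h (h + L)) (+-suc L b)) ⟩
      suc (suc m) * afterUp (suc (L + b)) h (h + L)
        ≡⟨ cong (suc (suc m) *_) (afterUp-unfold (suc (L + b)) h (h + L)) ⟩
      suc (suc m) * (afterUpU (suc (L + b)) h (h + L) + inRun true (L + b) h 0 (h + L))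
        ≡⟨ closed-form-step b m h L _ _ X Y W M (runSum true b 0 h L)
             n≡ (up-closed h) (inRun-closed true b (afterUp-closed b) L h 0)
             (multichoose-absorption′ q (suc b)) W≡ (runSum-labelled b h L) ⟩
      suc h * Y * M ∎
      where
      open ≡-Reasoning
      m = L + b + h
      q = suc (h + L)
      X = multichoose q (suc b)
      Y = multichoose (suc q) (suc b)
      W = multichoose (suc q) b
      n≡ : suc m ≡ L + suc b + h
      n≡ = sym (cong (_+ h) (+-suc L b))
      up-closed : ∀ h → suc (L + b + h) * afterUpU (suc (L + b)) h (h + L) ≡ h * multichoose (suc (h + L)) (suc b) * M
      up-closed zero    = *-zeroʳ (suc (L + b + 0))
      up-closed (suc h) =
        trans (cong₂ _*_ (cong suc (trans (+-suc (L + b) h) (cong (_+ h) (sym (+-suc L b)))))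
                         (cong (λ g → afterUp g h (h + L)) (sym (+-suc L b))))
              (closed h)
      W≡ : (q + suc b) * W ≡ suc b * Y
      W≡ = trans (cong (_* W) (+-suc q b))
                 (trans (multichoose-absorption′ (suc q) b) (sym (multichoose-absorption (suc q) b)))

  pathCount-closed : ∀ a k →
    suc (k + a) * pathCount (suc (k + a)) k ≡ multichoose (2 + k) a * multichoose (2 + a * p) k
  pathCount-closed a k = begin
    suc (k + a) * pathCount (suc (k + a)) k
      ≡⟨ cong₂ _*_ (cong suc (sym (+-identityʳ (k + a)))) (count≡inRun false (k + a) 0 0 k) ⟩
    suc (k + a + 0) * inRun false (k + a) 0 0 (0 + k)
      ≡⟨ inRun-closed false a (afterUp-closed a) k 0 0 ⟩
    multichoose (2 + k) a * runSum false a 0 0 k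
      ≡⟨ cong (multichoose (2 + k) a *_) (runSum-unlabelled a k) ⟩
    multichoose (2 + k) a * multichoose (2 + a * p) k ∎
    where open ≡-Reasoning

  n<k⇒pathCount≡0 : ∀ n k → n < k → pathCount (suc n) k ≡ 0
  n<k⇒pathCount≡0 n k n<k =
    trans (count≡inRun false n 0 0 k) (g+h<k⇒inRun≡0 false n 0 0 k (subst (_< k) (sym (+-identityʳ n)) n<k))

-- The formula for N

N-numerator≡multichoose : ∀ e a k →
  ((k + a + 1) C (k + 1)) * ((k + a + (k + a ∸ k) * e + 1) C k) ≡
  multichoose (2 + k) a * multichoose (2 + a * suc e) k
N-numerator≡multichoose e a k = cong₂ _*_ first second
  where
  first : (k + a + 1) C (k + 1) ≡ multichoose (2 + k) a
  first = begin
    (k + a + 1) C (k + 1)             ≡⟨ cong (_C (k + 1)) (rearrange k a) ⟩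
    (a + (k + 1)) C (k + 1)           ≡⟨ C≡multichoose a (k + 1) ⟩
    multichoose (suc a) (k + 1)       ≡⟨ multichoose-sym a (k + 1) ⟩
    multichoose (suc (k + 1)) a       ≡⟨ cong (λ m → multichoose (suc m) a) (+-comm k 1) ⟩
    multichoose (2 + k) a             ∎
    where
    open ≡-Reasoning
    rearrange : ∀ k a → k + a + 1 ≡ a + (k + 1)
    rearrange = solve-∀
  second : (k + a + (k + a ∸ k) * e + 1) C k ≡ multichoose (2 + a * suc e) k
  second = begin
    (k + a + (k + a ∸ k) * e + 1) C k  ≡⟨ cong (λ m → (k + a + m * e + 1) C k) (m+n∸m≡n k a) ⟩
    (k + a + a * e + 1) C k            ≡⟨ cong (_C k) (rearrange k a e) ⟩
    (suc (a * suc e) + k) C k          ≡⟨ C≡multichoose (suc (a * suc e)) k ⟩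
    multichoose (2 + a * suc e) k      ∎
    where
    open ≡-Reasoning
    rearrange : ∀ k a e → k + a + a * e + 1 ≡ suc (a * suc e) + k
    rearrange = solve-∀

N[k+a]≡pathCount : ∀ e a k → N (2 + e) (k + a) k ≡ pathCount (suc e) (suc (k + a)) k
N[k+a]≡pathCount e a k = begin
  (((k + a + 1) C (k + 1)) * ((k + a + (k + a ∸ k) * e + 1) C k)) / suc n
    ≡⟨ cong (_/ suc n) (N-numerator≡multichoose e a k) ⟩
  (multichoose (2 + k) a * multichoose (2 + a * suc e) k) / suc n
    ≡⟨ cong (_/ suc n) (pathCount-closed (suc e) a k) ⟨
  (suc n * paths) / suc n
    ≡⟨ cong (_/ suc n) (*-comm (suc n) paths) ⟩
  (paths * suc n) / suc n
    ≡⟨ m*n/n≡m paths (suc n) ⟩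
  paths ∎
  where
  open ≡-Reasoning
  n = k + a
  paths = pathCount (suc e) (suc n) k

N≡pathCount : ∀ e n k → N (2 + e) n k ≡ pathCount (suc e) (suc n) k
N≡pathCount e n k with k ≤? n
... | yes k≤n = subst (λ n → N (2 + e) n k ≡ pathCount (suc e) (suc n) k)
                      (m+[n∸m]≡n k≤n) (N[k+a]≡pathCount e (n ∸ k) k)
... | no k≰n = begin
  (((n + 1) C (k + 1)) * ((n + (n ∸ k) * e + 1) C k)) / suc n
    ≡⟨ cong (λ m → (m * ((n + (n ∸ k) * e + 1) C k)) / suc n) (k>n⇒nCk≡0 (+-monoˡ-< 1 (≰⇒> k≰n))) ⟩
  0 / suc n
    ≡⟨ 0/n≡0 (suc n) ⟩
  0
    ≡⟨ n<k⇒pathCount≡0 (suc e) n k (≰⇒> k≰n) ⟨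
  pathCount (suc e) (suc n) k ∎
  where open ≡-Reasoning

theorem4p3 : (d n k : ℕ) → 2 ≤ d → Fin (N d n k) ↔ LabelledPaths d (n + 1) k
theorem4p3 (suc zero)    n k (s≤s ())
theorem4p3 (suc (suc e)) n k _ = ↔-sym (begin
  LabelledPaths (2 + e) (n + 1) k     ↔⟨ LabelledPaths↔pathCount (suc e) (n + 1) k ⟩
  Fin (pathCount (suc e) (n + 1) k)   ≡⟨ cong (λ m → Fin (pathCount (suc e) m k)) (+-comm n 1) ⟩
  Fin (pathCount (suc e) (1 + n) k)   ≡⟨ cong Fin (N≡pathCount e n k) ⟨
  Fin (N (2 + e) n k)                 ∎)
  where open EquationalReasoning
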